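{- There is a bijection $\pi\mapsto f$ between the set of all permutations $\pi$ of $\{1,\ldots,n\}$ and the set of excedant functions $f:\{1,\ldots,n\}\to\{1,\ldots,n\}$ such that, for each $\pi$, a number $k\in\{1,\ldots,n\}$ does not belong to $\{f(1),\ldots,f(n)\}$ if and only if $\pi(i+1)=k$ for some descent $i$ of $\pi$.
   Context: A function $f$ on a set of integers is excedant if $f(i)\ge i$ for all $i$. A descent of a permutation $\pi$ of $\{1,\ldots,n\}$ is an $i\in\{1,\ldots,n-1\}$ with $\pi(i)>\pi(i+1)$. -}

module Defs where

open import Data.Nat using (ℕ; suc; _<_)
open import Data.Nat.Properties using (<-trans; n<1+n)
open import Data.Fin using (Fin; fromℕ<; toℕ) renaming (_≤_ to _≤ᶠ_; _>_ to _>ᶠ_)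
open import Data.Fin.Permutation using (Permutation′; _⟨$⟩ʳ_)
open import Data.Product using (Σ; ∃; _×_; _,_; proj₁)
open import Relation.Binary.PropositionalEquality using (_≡_)
open import Relation.Nullary using (¬_)

-- Convention: {1,…,n} is represented by Fin n = {0,…,n-1} (shift by one).

Excedant : (n : ℕ) → (Fin n → Fin n) → Set
Excedant n f = ∀ i → i ≤ᶠ f i

ExcedantFun : ℕ → Set
ExcedantFun n = Σ (Fin n → Fin n) (Excedant n)

pos : ∀ {n} (i : ℕ) → suc i < n → Fin n
pos i h = fromℕ< (<-trans (n<1+n i) h)

pos+1 : ∀ {n} (i : ℕ) → suc i < n → Fin n
pos+1 i h = fromℕ< h

IsDescent : ∀ {n} → Permutation′ n → (i : ℕ) → suc i < n → Set
IsDescent π i h = (π ⟨$⟩ʳ pos i h) >ᶠ (π ⟨$⟩ʳ pos+1 i h)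

DescentBottom : ∀ {n} → Permutation′ n → Fin n → Set
DescentBottom π k = ∃ λ i → Σ (suc i < _) λ h → IsDescent π i h × (π ⟨$⟩ʳ pos+1 i h ≡ k)

InImage : ∀ {n} → (Fin n → Fin n) → Fin n → Set
InImage f k = ∃ λ i → f i ≡ k

_≗ᵖ_ : ∀ {n} → Permutation′ n → Permutation′ n → Set
π ≗ᵖ σ = ∀ i → π ⟨$⟩ʳ i ≡ σ ⟨$⟩ʳ i

_≗ᵉ_ : ∀ {n} → ExcedantFun n → ExcedantFun n → Set
f ≗ᵉ g = ∀ i → proj₁ f i ≡ proj₁ g i

IsBijection : ∀ {n} → (Permutation′ n → ExcedantFun n) → Set
IsBijection {n} Φ =
  (∀ π σ → π ≗ᵖ σ → Φ π ≗ᵉ Φ σ) ×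
  (∀ π σ → Φ π ≗ᵉ Φ σ → π ≗ᵖ σ) ×
  (∀ (f : ExcedantFun n) → ∃ λ π → Φ π ≗ᵉ f)

-- A permutation π of {0,…,n} is determined by the position p of its value 0 together with the
-- permutation ρ of the other positions and values. Its excedant code f starts with f(0) = 0
-- if p = 0 and otherwise with the value following 0 in π (cyclically), and continues with 1 + the
-- code of ρ. For fixed ρ, p ↦ f(0) is a bijection fixing 0, which gives the bijection by induction.
-- Deleting 0 keeps every adjacency of π except that it joins the two neighbours of 0. Hence 0 is
-- a descent bottom iff p ≠ 0, and k + 1 is one iff k is one of ρ and k + 1 ≠ f(0) (the cyclic
-- wrap-around is harmless: the first entry is never a descent bottom); in both cases this says
-- that the value is missed by f.
module Submission where

open import Defs
open import Data.Nat using (ℕ)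
open import Data.Fin using (Fin)
open import Data.Fin.Permutation using (Permutation′)
open import Data.Product using (Σ; _×_; proj₁)
open import Relation.Nullary using (¬_)
open import Function.Bundles using (_⇔_)

import Data.Nat as ℕ
open import Data.Nat using (zero; suc; z≤n; s≤s)
import Data.Nat.Properties as ℕ
open import Data.Fin using (zero; suc; toℕ; inject₁; fromℕ; lower₁; punchIn; punchOut; _≟_; _<_)
open import Data.Fin.Properties
  using (0≢1+n; suc-injective; toℕ-injective; toℕ<n; toℕ-fromℕ; toℕ-fromℕ<; fromℕ<-toℕ;
         toℕ-inject₁; toℕ-inject₁-≢; lower₁-inject₁′; inject₁-lower₁; punchIn-punchOut)
open import Data.Fin.Permutation
  using (_⟨$⟩ʳ_; _⟨$⟩ˡ_; _≈_; _∘ₚ_; id; permutation; inverseˡ; inverseʳ; lift₀; lift₀-cong;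
         remove; insert; punchIn-permute′; remove-insert)
open import Data.Product using (∃; ∃₂; _,_; proj₂)
import Data.Product as Product
open import Data.Product.Function.NonDependent.Propositional using (_×-⇔_)
open import Data.Sum using (_⊎_; inj₁; inj₂)
import Data.Sum as Sum
open import Function using (_∘_)
open import Function.Bundles using (Equivalence; Injection; mk⇔)
import Function.Properties.Equivalence as ⇔
open import Function.Properties.Inverse using (↔⇒↣)
open import Relation.Binary.PropositionalEquality
  using (_≡_; _≢_; refl; sym; trans; cong; subst; subst₂; module ≡-Reasoning)
open import Relation.Nullary using (yes; no)
open import Relation.Nullary.Negation using (contradiction)

infix 4 _⋖_

_⋖_ : ∀ {n} → Fin n → Fin n → Set
a ⋖ b = suc (toℕ a) ≡ toℕ b

toℕ-punchIn : ∀ {n} (p : Fin (suc n)) (x : Fin n) →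
  (toℕ x ℕ.< toℕ p × toℕ (punchIn p x) ≡ toℕ x) ⊎
  (toℕ p ℕ.≤ toℕ x × toℕ (punchIn p x) ≡ suc (toℕ x))
toℕ-punchIn zero    x       = inj₂ (z≤n , refl)
toℕ-punchIn (suc p) zero    = inj₁ (s≤s z≤n , refl)
toℕ-punchIn (suc p) (suc x) =
  Sum.map (Product.map s≤s (cong suc)) (Product.map s≤s (cong suc)) (toℕ-punchIn p x)

≡inject₁⇒toℕ≡ : ∀ {n} {p : Fin (suc n)} {b : Fin n} → p ≡ inject₁ b → toℕ p ≡ toℕ b
≡inject₁⇒toℕ≡ {b = b} refl = toℕ-inject₁ b

toℕ≡⇒≡inject₁ : ∀ {n} {p : Fin (suc n)} {b : Fin n} → toℕ p ≡ toℕ b → p ≡ inject₁ b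
toℕ≡⇒≡inject₁ {b = b} e = toℕ-injective (trans e (sym (toℕ-inject₁ b)))

punchIn-⋖ : ∀ {n} (p : Fin (suc n)) (a b : Fin n) →
  punchIn p a ⋖ punchIn p b ⇔ (a ⋖ b × p ≢ inject₁ b)
punchIn-⋖ p a b with toℕ-punchIn p a | toℕ-punchIn p b
... | inj₁ (a<p , ea) | inj₁ (b<p , eb) rewrite ea | eb =
  mk⇔ (λ a⋖b → a⋖b , λ p≡b → ℕ.<-irrefl (sym (≡inject₁⇒toℕ≡ p≡b)) b<p) proj₁
... | inj₂ (p≤a , ea) | inj₂ (p≤b , eb) rewrite ea | eb =
  mk⇔ (λ e → ℕ.suc-injective e , λ p≡b → ℕ.<-irrefl (≡inject₁⇒toℕ≡ p≡b)
                 (subst (toℕ p ℕ.<_) (ℕ.suc-injective e) (ℕ.s≤s p≤a)))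
      (cong suc ∘ proj₁)
... | inj₁ (a<p , ea) | inj₂ (p≤b , eb) rewrite ea | eb =
  mk⇔ (λ e → contradiction (ℕ.suc-injective e) (ℕ.<⇒≢ (ℕ.<-≤-trans a<p p≤b)))
      (λ (a⋖b , p≢b) →
         contradiction (toℕ≡⇒≡inject₁ (ℕ.≤-antisym p≤b (subst (ℕ._≤ toℕ p) a⋖b a<p))) p≢b)
... | inj₂ (p≤a , ea) | inj₁ (b<p , eb) rewrite ea | eb =
  mk⇔ (λ e → contradiction (subst (suc (toℕ a) ℕ.≤_) e (ℕ.n≤1+n _)) b≯a)
      (λ (a⋖b , _) → contradiction (subst (suc (toℕ a) ℕ.≤_) a⋖b ℕ.≤-refl) b≯a)
  where
  b≯a : ¬ toℕ a ℕ.< toℕ b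
  b≯a a<b = ℕ.<-irrefl refl (ℕ.<-trans a<b (ℕ.<-≤-trans b<p p≤a))

rotate : ∀ {n} → Permutation′ n
rotate {zero}  = id
rotate {suc m} = permutation next prev next-prev prev-next
  where
  next : Fin (suc m) → Fin (suc m)
  next q with m ℕ.≟ toℕ q
  ... | yes _   = zero
  ... | no m≢q  = suc (lower₁ q m≢q)

  prev : Fin (suc m) → Fin (suc m)
  prev zero    = fromℕ m
  prev (suc c) = inject₁ c

  next-prev : ∀ q → next (prev q) ≡ q
  next-prev zero with m ℕ.≟ toℕ (fromℕ m)
  ... | yes _   = refl
  ... | no m≢m  = contradiction (sym (toℕ-fromℕ m)) m≢m
  next-prev (suc c) with m ℕ.≟ toℕ (inject₁ c)
  ... | yes m≡c = contradiction m≡c (toℕ-inject₁-≢ c)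
  ... | no m≢c  = cong suc (lower₁-inject₁′ c m≢c)

  prev-next : ∀ q → prev (next q) ≡ q
  prev-next q with m ℕ.≟ toℕ q
  ... | yes m≡q = toℕ-injective (trans (toℕ-fromℕ m) m≡q)
  ... | no m≢q  = inject₁-lower₁ q m≢q

rotate-inject₁ : ∀ {m} (c : Fin m) → rotate ⟨$⟩ʳ inject₁ c ≡ suc c
rotate-inject₁ c = inverseʳ rotate {suc c}

⟨$⟩ʳ-injective : ∀ {n} (π : Permutation′ n) {i j} → π ⟨$⟩ʳ i ≡ π ⟨$⟩ʳ j → i ≡ j
⟨$⟩ʳ-injective π = Injection.injective (↔⇒↣ π)

insert-at : ∀ {n} (p : Fin (suc n)) (j : Fin (suc n)) (ρ : Permutation′ n) → insert p j ρ ⟨$⟩ʳ p ≡ j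
insert-at p j ρ with p ≟ p
... | yes _   = refl
... | no p≢p  = contradiction refl p≢p

zeroPos : ∀ {n} → Permutation′ (suc n) → Fin (suc n)
zeroPos π = π ⟨$⟩ˡ zero

removeZero : ∀ {n} → Permutation′ (suc n) → Permutation′ n
removeZero π = remove (zeroPos π) π

permute-punchIn-zeroPos : ∀ {n} (π : Permutation′ (suc n)) j →
  π ⟨$⟩ʳ punchIn (zeroPos π) j ≡ suc (removeZero π ⟨$⟩ʳ j)
permute-punchIn-zeroPos π = punchIn-permute′ π zero

zeroPos-cong : ∀ {n} (π σ : Permutation′ (suc n)) → π ≈ σ → zeroPos π ≡ zeroPos σ
zeroPos-cong π σ π≈σ = ⟨$⟩ʳ-injective π (begin
  π ⟨$⟩ʳ zeroPos π  ≡⟨ inverseʳ π ⟩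
  zero              ≡⟨ inverseʳ σ ⟨
  σ ⟨$⟩ʳ zeroPos σ  ≡⟨ π≈σ (zeroPos σ) ⟨
  π ⟨$⟩ʳ zeroPos σ  ∎)
  where open ≡-Reasoning

removeZero-cong : ∀ {n} (π σ : Permutation′ (suc n)) → π ≈ σ → removeZero π ≈ removeZero σ
removeZero-cong π σ π≈σ j = suc-injective (begin
  suc (removeZero π ⟨$⟩ʳ j)         ≡⟨ permute-punchIn-zeroPos π j ⟨
  π ⟨$⟩ʳ punchIn (zeroPos π) j      ≡⟨ π≈σ _ ⟩
  σ ⟨$⟩ʳ punchIn (zeroPos π) j      ≡⟨ cong (λ p → σ ⟨$⟩ʳ punchIn p j) (zeroPos-cong π σ π≈σ) ⟩
  σ ⟨$⟩ʳ punchIn (zeroPos σ) j      ≡⟨ permute-punchIn-zeroPos σ j ⟩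
  suc (removeZero σ ⟨$⟩ʳ j)         ∎)
  where open ≡-Reasoning

zeroPos-removeZero-injective : ∀ {n} (π σ : Permutation′ (suc n)) →
  zeroPos π ≡ zeroPos σ → removeZero π ≈ removeZero σ → π ≈ σ
zeroPos-removeZero-injective π σ p≡ ρ≈ j with zeroPos π ≟ j
... | yes refl = trans (inverseʳ π) (sym (trans (cong (σ ⟨$⟩ʳ_) p≡) (inverseʳ σ)))
... | no p≢j = begin
  π ⟨$⟩ʳ j                                ≡⟨ cong (π ⟨$⟩ʳ_) (punchIn-punchOut p≢j) ⟨
  π ⟨$⟩ʳ punchIn (zeroPos π) j′           ≡⟨ permute-punchIn-zeroPos π j′ ⟩
  suc (removeZero π ⟨$⟩ʳ j′)              ≡⟨ cong suc (ρ≈ j′) ⟩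
  suc (removeZero σ ⟨$⟩ʳ j′)              ≡⟨ permute-punchIn-zeroPos σ j′ ⟨
  σ ⟨$⟩ʳ punchIn (zeroPos σ) j′           ≡⟨ cong (λ p → σ ⟨$⟩ʳ punchIn p j′) p≡ ⟨
  σ ⟨$⟩ʳ punchIn (zeroPos π) j′           ≡⟨ cong (σ ⟨$⟩ʳ_) (punchIn-punchOut p≢j) ⟩
  σ ⟨$⟩ʳ j                                ∎
  where
  open ≡-Reasoning
  j′ = punchOut p≢j

zeroPos-insert : ∀ {n} (p : Fin (suc n)) (ρ : Permutation′ n) → zeroPos (insert p zero ρ) ≡ p
zeroPos-insert p ρ =
  trans (cong (insert p zero ρ ⟨$⟩ˡ_) (sym (insert-at p zero ρ))) (inverseˡ (insert p zero ρ))

removeZero-insert : ∀ {n} (p : Fin (suc n)) (ρ : Permutation′ n) → removeZero (insert p zero ρ) ≈ ρ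
removeZero-insert p ρ rewrite zeroPos-insert p ρ = remove-insert p zero ρ

-- leading ρ ⟨$⟩ʳ p is the first value of the code of the permutation having 0 at position p
-- and ρ at the other positions: 0 if p = 0, and otherwise the value at position p + 1,
-- positions being read cyclically.
leading : ∀ {n} → Permutation′ n → Permutation′ (suc n)
leading ρ = lift₀ (rotate ∘ₚ ρ)

leading-cong : ∀ {n} (ρ σ : Permutation′ n) → ρ ≈ σ → leading ρ ≈ leading σ
leading-cong ρ σ ρ≈σ = lift₀-cong (rotate ∘ₚ ρ) (rotate ∘ₚ σ) (ρ≈σ ∘ (rotate ⟨$⟩ʳ_))

leading-inject₁ : ∀ {n} (ρ : Permutation′ n) {a b : Fin n} → a ⋖ b →
  leading ρ ⟨$⟩ʳ inject₁ b ≡ suc (ρ ⟨$⟩ʳ b)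
leading-inject₁ ρ {b = suc c} _ = cong (suc ∘ (ρ ⟨$⟩ʳ_)) (rotate-inject₁ c)

excedantCode : ∀ {n} → Permutation′ n → Fin n → Fin n
excedantCode {suc n} π zero    = leading (removeZero π) ⟨$⟩ʳ zeroPos π
excedantCode {suc n} π (suc i) = suc (excedantCode (removeZero π) i)

excedantCode-excedant : ∀ {n} (π : Permutation′ n) → Excedant n (excedantCode π)
excedantCode-excedant {suc n} π zero    = z≤n
excedantCode-excedant {suc n} π (suc i) = s≤s (excedantCode-excedant (removeZero π) i)

excedantCode-cong : ∀ {n} (π σ : Permutation′ n) → π ≈ σ →
  ∀ i → excedantCode π i ≡ excedantCode σ i
excedantCode-cong {suc n} π σ π≈σ zero = begin
  leading (removeZero π) ⟨$⟩ʳ zeroPos π  ≡⟨ leading-cong (removeZero π) (removeZero σ) (removeZero-cong π σ π≈σ) _ ⟩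
  leading (removeZero σ) ⟨$⟩ʳ zeroPos π  ≡⟨ cong (leading (removeZero σ) ⟨$⟩ʳ_) (zeroPos-cong π σ π≈σ) ⟩
  leading (removeZero σ) ⟨$⟩ʳ zeroPos σ  ∎
  where open ≡-Reasoning
excedantCode-cong {suc n} π σ π≈σ (suc i) =
  cong suc (excedantCode-cong (removeZero π) (removeZero σ) (removeZero-cong π σ π≈σ) i)

excedantCode-injective : ∀ {n} (π σ : Permutation′ n) →
  (∀ i → excedantCode π i ≡ excedantCode σ i) → π ≈ σ
excedantCode-injective {zero} _ _ _ ()
excedantCode-injective {suc n} π σ code≡ =
  zeroPos-removeZero-injective π σ zeroPos≡ removeZero≈
  where
  removeZero≈ : removeZero π ≈ removeZero σ
  removeZero≈ = excedantCode-injective (removeZero π) (removeZero σ) (suc-injective ∘ code≡ ∘ suc)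
  zeroPos≡ : zeroPos π ≡ zeroPos σ
  zeroPos≡ = ⟨$⟩ʳ-injective (leading (removeZero π))
    (trans (code≡ zero) (sym (leading-cong (removeZero π) (removeZero σ) removeZero≈ (zeroPos σ))))

excedant-tail : ∀ {n} {f : Fin (suc n) → Fin (suc n)} → Excedant (suc n) f →
  Σ (Fin n → Fin n) λ g → Excedant n g × (∀ i → suc (g i) ≡ f (suc i))
excedant-tail {n} {f} f-exc = g , g-exc , suc-g
  where
  f∘suc≢0 : ∀ i → zero ≢ f (suc i)
  f∘suc≢0 i 0≡ = contradiction (subst (λ k → suc (toℕ i) ℕ.≤ toℕ k) (sym 0≡) (f-exc (suc i))) λ ()
  g : Fin n → Fin n
  g i = punchOut (f∘suc≢0 i)
  suc-g : ∀ i → suc (g i) ≡ f (suc i)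
  suc-g i = punchIn-punchOut (f∘suc≢0 i)
  g-exc : Excedant n g
  g-exc i = ℕ.s≤s⁻¹ (subst (λ k → suc (toℕ i) ℕ.≤ toℕ k) (sym (suc-g i)) (f-exc (suc i)))

excedantCode-surjective : ∀ {n} (f : Fin n → Fin n) → Excedant n f →
  ∃ λ π → ∀ i → excedantCode π i ≡ f i
excedantCode-surjective {zero}  f _ = id , λ ()
excedantCode-surjective {suc n} f f-exc with excedant-tail f-exc
... | g , g-exc , suc-g with excedantCode-surjective g g-exc
... | ρ , code≡g = π , code≡f
  where
  open ≡-Reasoning
  p = leading ρ ⟨$⟩ˡ f zero
  π = insert p zero ρ
  code≡f : ∀ i → excedantCode π i ≡ f i
  code≡f zero = begin
    leading (removeZero π) ⟨$⟩ʳ zeroPos π  ≡⟨ leading-cong (removeZero π) ρ (removeZero-insert p ρ) _ ⟩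
    leading ρ ⟨$⟩ʳ zeroPos π               ≡⟨ cong (leading ρ ⟨$⟩ʳ_) (zeroPos-insert p ρ) ⟩
    leading ρ ⟨$⟩ʳ p                       ≡⟨ inverseʳ (leading ρ) ⟩
    f zero                                 ∎
  code≡f (suc i) = begin
    suc (excedantCode (removeZero π) i)  ≡⟨ cong suc (excedantCode-cong (removeZero π) ρ (removeZero-insert p ρ) i) ⟩
    suc (excedantCode ρ i)               ≡⟨ cong suc (code≡g i) ⟩
    suc (g i)                            ≡⟨ suc-g i ⟩
    f (suc i)                            ∎

DescentBottom′ : ∀ {n} → Permutation′ n → Fin n → Set
DescentBottom′ π k = ∃₂ λ a b → a ⋖ b × π ⟨$⟩ʳ b < π ⟨$⟩ʳ a × π ⟨$⟩ʳ b ≡ k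

descentBottom⇔descentBottom′ : ∀ {n} (π : Permutation′ n) k → DescentBottom π k ⇔ DescentBottom′ π k
descentBottom⇔descentBottom′ {n} π k = mk⇔ to from
  where
  to : DescentBottom π k → DescentBottom′ π k
  to (i , i+1<n , desc , πb≡k) =
    pos i i+1<n , pos+1 i i+1<n , trans (cong suc (toℕ-fromℕ< _)) (sym (toℕ-fromℕ< i+1<n)) , desc , πb≡k
  from : DescentBottom′ π k → DescentBottom π k
  from (a , b , a⋖b , πb<πa , πb≡k) =
    toℕ a , a+1<n ,
    subst₂ (λ a b → π ⟨$⟩ʳ b < π ⟨$⟩ʳ a × π ⟨$⟩ʳ b ≡ k) (sym pos≡a) (sym pos+1≡b) (πb<πa , πb≡k)
    where
    a+1<n : suc (toℕ a) ℕ.< n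
    a+1<n = subst (ℕ._< n) (sym a⋖b) (toℕ<n b)
    pos≡a : pos (toℕ a) a+1<n ≡ a
    pos≡a = fromℕ<-toℕ a _
    pos+1≡b : pos+1 (toℕ a) a+1<n ≡ b
    pos+1≡b = toℕ-injective (trans (toℕ-fromℕ< a+1<n) a⋖b)

descentBottom′-zero-at : ∀ {n} (π : Permutation′ (suc n)) {x} → π ⟨$⟩ʳ x ≡ zero → x ≢ zero →
  DescentBottom′ π zero
descentBottom′-zero-at π {zero}  _     x≢0 = contradiction refl x≢0
descentBottom′-zero-at π {suc q} πx≡0 _   =
  inject₁ q , suc q , cong suc (toℕ-inject₁ q) , πx<πq , πx≡0
  where
  πq≢0 : toℕ (π ⟨$⟩ʳ inject₁ q) ≢ 0
  πq≢0 πq≡0 = ℕ.1+n≢n (trans (cong toℕ x≡q) (toℕ-inject₁ q))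
    where
    x≡q : suc q ≡ inject₁ q
    x≡q = ⟨$⟩ʳ-injective π (trans πx≡0 (sym (toℕ-injective πq≡0)))
  πx<πq : π ⟨$⟩ʳ suc q < π ⟨$⟩ʳ inject₁ q
  πx<πq = subst (λ v → toℕ v ℕ.< toℕ (π ⟨$⟩ʳ inject₁ q)) (sym πx≡0) (ℕ.n≢0⇒n>0 πq≢0)

module _ {n} (π : Permutation′ (suc n)) where
  private
    p = zeroPos π
    ρ = removeZero π
    π-zeroPos : π ⟨$⟩ʳ p ≡ zero
    π-zeroPos = inverseʳ π
    π-punchIn : ∀ j → π ⟨$⟩ʳ punchIn p j ≡ suc (ρ ⟨$⟩ʳ j)
    π-punchIn = permute-punchIn-zeroPos π

  descentBottom′-zero : DescentBottom′ π zero ⇔ p ≢ zero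
  descentBottom′-zero = mk⇔ to from
    where
    to : DescentBottom′ π zero → p ≢ zero
    to (a , b , a⋖b , _ , πb≡0) p≡0 = ℕ.1+n≢0 (trans a⋖b (cong toℕ b≡0))
      where
      b≡0 : b ≡ zero
      b≡0 = trans (⟨$⟩ʳ-injective π (trans πb≡0 (sym π-zeroPos))) p≡0
    from : p ≢ zero → DescentBottom′ π zero
    from = descentBottom′-zero-at π π-zeroPos

  descentBottom′-suc : ∀ k →
    DescentBottom′ π (suc k) ⇔ (DescentBottom′ ρ k × leading ρ ⟨$⟩ʳ p ≢ suc k)
  descentBottom′-suc k = mk⇔ to from
    where
    to : DescentBottom′ π (suc k) → DescentBottom′ ρ k × leading ρ ⟨$⟩ʳ p ≢ suc k
    to (a , b , a⋖b , πb<πa , πb≡k+1) = (a′ , b′ , a′⋖b′ , ρb′<ρa′ , ρb′≡k) , lead≢k+1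
      where
      p≢a : p ≢ a
      p≢a p≡a = ℕ.n≮0 (subst (λ v → toℕ (π ⟨$⟩ʳ b) ℕ.< toℕ v) πa≡0 πb<πa)
        where
        πa≡0 : π ⟨$⟩ʳ a ≡ zero
        πa≡0 = trans (cong (π ⟨$⟩ʳ_) (sym p≡a)) π-zeroPos
      p≢b : p ≢ b
      p≢b p≡b = 0≢1+n (trans (sym π-zeroPos) (trans (cong (π ⟨$⟩ʳ_) p≡b) πb≡k+1))
      a′ = punchOut p≢a
      b′ = punchOut p≢b
      πa≡ : π ⟨$⟩ʳ a ≡ suc (ρ ⟨$⟩ʳ a′)
      πa≡ = trans (cong (π ⟨$⟩ʳ_) (sym (punchIn-punchOut p≢a))) (π-punchIn a′)
      πb≡ : π ⟨$⟩ʳ b ≡ suc (ρ ⟨$⟩ʳ b′)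
      πb≡ = trans (cong (π ⟨$⟩ʳ_) (sym (punchIn-punchOut p≢b))) (π-punchIn b′)
      a′⋖b′×p≢b′ : a′ ⋖ b′ × p ≢ inject₁ b′
      a′⋖b′×p≢b′ = Equivalence.to (punchIn-⋖ p a′ b′)
        (subst₂ _⋖_ (sym (punchIn-punchOut p≢a)) (sym (punchIn-punchOut p≢b)) a⋖b)
      a′⋖b′ = proj₁ a′⋖b′×p≢b′
      ρb′≡k : ρ ⟨$⟩ʳ b′ ≡ k
      ρb′≡k = suc-injective (trans (sym πb≡) πb≡k+1)
      ρb′<ρa′ : ρ ⟨$⟩ʳ b′ < ρ ⟨$⟩ʳ a′
      ρb′<ρa′ = ℕ.s<s⁻¹ (subst₂ (λ u v → toℕ u ℕ.< toℕ v) πb≡ πa≡ πb<πa)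
      lead≢k+1 : leading ρ ⟨$⟩ʳ p ≢ suc k
      lead≢k+1 lead≡ = proj₂ a′⋖b′×p≢b′ (⟨$⟩ʳ-injective (leading ρ)
        (trans lead≡ (sym (trans (leading-inject₁ ρ a′⋖b′) (cong suc ρb′≡k)))))
    from : DescentBottom′ ρ k × leading ρ ⟨$⟩ʳ p ≢ suc k → DescentBottom′ π (suc k)
    from ((a′ , b′ , a′⋖b′ , ρb′<ρa′ , ρb′≡k) , lead≢k+1) =
      punchIn p a′ , punchIn p b′ ,
      Equivalence.from (punchIn-⋖ p a′ b′) (a′⋖b′ , p≢b′) ,
      subst₂ (λ u v → toℕ u ℕ.< toℕ v) (sym (π-punchIn b′)) (sym (π-punchIn a′)) (ℕ.s<s ρb′<ρa′) ,
      trans (π-punchIn b′) (cong suc ρb′≡k)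
      where
      p≢b′ : p ≢ inject₁ b′
      p≢b′ p≡b′ = lead≢k+1 (trans (cong (leading ρ ⟨$⟩ʳ_) p≡b′)
                                  (trans (leading-inject₁ ρ a′⋖b′) (cong suc ρb′≡k)))

  ∉image-zero : (¬ InImage (excedantCode π) zero) ⇔ p ≢ zero
  ∉image-zero = mk⇔
    (λ ∉im p≡0 → ∉im (zero , cong (leading ρ ⟨$⟩ʳ_) p≡0))
    (λ { p≢0 (zero , lead≡0) → p≢0 (⟨$⟩ʳ-injective (leading ρ) lead≡0) })

  ∉image-suc : ∀ k →
    (¬ InImage (excedantCode π) (suc k)) ⇔ (¬ InImage (excedantCode ρ) k × leading ρ ⟨$⟩ʳ p ≢ suc k)
  ∉image-suc k = mk⇔
    (λ ∉im → (λ (i , e) → ∉im (suc i , cong suc e)) , (λ e → ∉im (zero , e)))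
    (λ { (_ , lead≢) (zero , e) → lead≢ e ; (∉imρ , _) (suc i , e) → ∉imρ (i , suc-injective e) })

∉image⇔descentBottom′ : ∀ {n} (π : Permutation′ n) k →
  (¬ InImage (excedantCode π) k) ⇔ DescentBottom′ π k
∉image⇔descentBottom′ {suc n} π zero = ⇔.trans (∉image-zero π) (⇔.sym (descentBottom′-zero π))
∉image⇔descentBottom′ {suc n} π (suc k) = ⇔.trans (∉image-suc π k) (⇔.trans
  (∉image⇔descentBottom′ (removeZero π) k ×-⇔ ⇔.refl) (⇔.sym (descentBottom′-suc π k)))

theorem6p4 : (n : ℕ) →
    Σ (Permutation′ n → ExcedantFun n) λ Φ →
      IsBijection Φ ×
      (∀ (π : Permutation′ n) (k : Fin n) →
        (¬ InImage (proj₁ (Φ π)) k) ⇔ DescentBottom π k)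
theorem6p4 n =
  (λ π → excedantCode π , excedantCode-excedant π) ,
  (excedantCode-cong , excedantCode-injective , λ (f , f-exc) → excedantCode-surjective f f-exc) ,
  λ π k → ⇔.trans (∉image⇔descentBottom′ π k) (⇔.sym (descentBottom⇔descentBottom′ π k))
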